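{- Let $\Gamma\subseteq\mathcal{L}'_{pqT}$ and let $\pi$ be a lex model with $\pi\models^*\Gamma$. Then: (1) if $\varphi\in\Gamma\cap\mathcal{L}_{pqT}$ is non-strict, then $\pi\models\varphi$; (2) if $\varphi\in\Gamma\cap\mathcal{L}_{pqT}$ is fully strict, then $\pi\models\varphi$ iff $R_\varphi\cap S_\varphi\cap V_\pi\neq\emptyset$; (3) if $\varphi\in\Gamma\cap\mathcal{L}_{pqT}$ is weakly strict, then $\pi\models\varphi$ iff $(R_\varphi\cup S_\varphi)\cap V_\pi\neq\emptyset$; (4) if $\neg\varphi\in\Gamma$, where $\varphi$ is a non-strict element of $\mathcal{L}_{pqT}$ with $R_\varphi=S_\varphi$, then $\pi\models\neg\varphi$ iff $V_\pi\not\subseteq T_\varphi\cup U_\varphi$. Consequently, $\pi\models\Gamma$ if and only if: for all fully strict $\varphi\in\Gamma\cap\mathcal{L}_{pqT}$, $R_\varphi\cap S_\varphi\cap V_\pi\ne\emptyset$; for all weakly strict $\varphi\in\Gamma\cap\mathcal{L}_{pqT}$, $(R_\varphi\cup S_\varphi)\cap V_\pi\ne\emptyset$; and for all $\neg\varphi\in\Gamma$ (with $\varphi$ non-strict, $R_\varphi=S_\varphi$), $V_\pi\not\subseteq T_\varphi\cup U_\varphi$.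
   Context: Let $V$ be a finite set of variables with finite nonempty domains $\underline{X}$; $\underline{A}=\prod_{X\in A}\underline{X}$; outcomes are elements of $\underline{V}$; $\alpha(U)$ is restriction. A lex model $\pi$ is a (possibly empty) sequence $(Y_1,\ge_{Y_1}),\ldots,(Y_k,\ge_{Y_k})$ of pairwise distinct variables each with a total order on its domain; $V_\pi=\{Y_1,\dots,Y_k\}$. $\alpha\succ_\pi\beta$ iff for some $i$, $\alpha(Y_j)=\beta(Y_j)$ for $j<i$ and $\alpha(Y_i)>_{Y_i}\beta(Y_i)$ strictly; $\alpha\equiv_\pi\beta$ iff $\alpha(V_\pi)=\beta(V_\pi)$; $\alpha\succcurlyeq_\pi\beta$ iff $\alpha\succ_\pi\beta$ or $\alpha\equiv_\pi\beta$. $\pi'$ extends $\pi$ if $\pi'\ne\pi$ and $\pi'$ begins with $\pi$; $\pi'\sqsupseteq\pi$ means extends or equals; $\pi\models^*\psi$ iff some $\pi'\sqsupseteq\pi$ satisfies $\psi$, and $\pi\models^*\Gamma$ iff $\pi\models^*\psi$ for all $\psi\in\Gamma$. Language $\mathcal{L}_{pqT}$: a statement $\varphi$ consists of $\rhd\in\{\ge,\gg,>\}$, pairwise disjoint sets $U_\varphi,T_\varphi,R_\varphi\cup S_\varphi\subseteq V$, assignments $u_\varphi\in\underline{U_\varphi}$, $r_\varphi\in\underline{R_\varphi}$, $s_\varphi\in\underline{S_\varphi}$ with $r_\varphi(Y)\ne s_\varphi(Y)$ for $Y\in R_\varphi\cap S_\varphi$, every variable with a one-element domain lying in $T_\varphi$;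 written $u_\varphi r_\varphi\rhd u_\varphi s_\varphi\parallel T_\varphi$. $\varphi^*$ is the set of pairs $(\alpha,\beta)$ of outcomes with $\alpha$ extending $u_\varphi,r_\varphi$, $\beta$ extending $u_\varphi,s_\varphi$, and $\alpha(T_\varphi)=\beta(T_\varphi)$. Non-strict ($\ge$): $\pi\models\varphi$ iff $\alpha\succcurlyeq_\pi\beta$ for all $(\alpha,\beta)\in\varphi^*$; fully strict ($\gg$): iff $\alpha\succ_\pi\beta$ for all pairs; weakly strict ($>$): iff the non-strict version holds and $\alpha\succ_\pi\beta$ for some pair. $\mathcal{L}'_{pqT}=\mathcal{L}_{pqT}\cup\{\neg\varphi:\varphi\in\mathcal{L}_{pqT}\text{ non-strict},\ R_\varphi=S_\varphi\}$, with $\pi\models\neg\varphi$ iff $\pi\not\models\varphi$. -}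

module Defs where

open import Level using (0ℓ; suc; Lift)
open import Data.Nat using (ℕ; zero) renaming (suc to 1+)
open import Data.Fin using (Fin)
open import Data.Fin.Subset using (Subset; _∈_; _∉_; _∩_; _∪_; Empty)
open import Data.List using (List; []; _∷_; _++_; map)
open import Data.List.Relation.Unary.All using (All)
open import Data.List.Relation.Unary.Any using (Any)
open import Data.List.Relation.Unary.Unique.Propositional using (Unique)
open import Data.Product using (Σ; ∃; _×_; _,_)
open import Data.Sum using (_⊎_)
open import Data.Empty using (⊥)
open import Relation.Binary using (Rel; IsTotalOrder)
open import Relation.Binary.PropositionalEquality using (_≡_; _≢_)
open import Relation.Nullary using (¬_)

-- Variables are Fin n; variable i has the (nonempty) domain Fin (1+ (d i)).
module Setup (n : ℕ) (d : Fin n → ℕ) where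

  Var : Set
  Var = Fin n

  Dom : Var → Set
  Dom i = Fin (1+ (d i))

  Outcome : Set
  Outcome = (i : Var) → Dom i

  Assignment : Subset n → Set
  Assignment A = (i : Var) → i ∈ A → Dom i

  Extends : {A : Subset n} → Outcome → Assignment A → Set
  Extends {A} α a = (i : Var) (p : i ∈ A) → α i ≡ a i p

  record Entry : Set₁ where
    constructor entry
    field
      var  : Var
      ord  : Rel (Dom var) 0ℓ
      isTO : IsTotalOrder _≡_ ord
  open Entry public

  record LexModel : Set₁ where
    constructor lexModel
    field
      entries  : List Entry
      distinct : Unique (map var entries)
  open LexModel public

  InV : LexModel → Var → Set₁
  InV π Y = Any (λ e → var e ≡ Y) (entries π)

  Strict : (e : Entry) → Dom (var e) → Dom (var e) → Set₁
  Strict e a b = Lift (suc 0ℓ) (ord e a b × a ≢ b)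

  GtL : List Entry → Outcome → Outcome → Set₁
  GtL [] α β = Lift (suc 0ℓ) ⊥
  GtL (e ∷ es) α β =
    Strict e (α (var e)) (β (var e)) ⊎ (Lift (suc 0ℓ) (α (var e) ≡ β (var e)) × GtL es α β)

  _≻[_]_ : Outcome → LexModel → Outcome → Set₁
  α ≻[ π ] β = GtL (entries π) α β

  _≡[_]_ : Outcome → LexModel → Outcome → Set₁
  α ≡[ π ] β = All (λ e → α (var e) ≡ β (var e)) (entries π)

  _≽[_]_ : Outcome → LexModel → Outcome → Set₁
  α ≽[ π ] β = α ≻[ π ] β ⊎ α ≡[ π ] β

  _⊒_ : LexModel → LexModel → Set₁
  π' ⊒ π = ∃ λ (rest : List Entry) → entries π' ≡ entries π ++ rest

  data Kind : Set where
    nonstrict fullystrict weaklystrict : Kind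

  record Stmt : Set where
    field
      kind : Kind
      U T R S : Subset n
      u : Assignment U
      r : Assignment R
      s : Assignment S
      disjUT  : Empty (U ∩ T)
      disjURS : Empty (U ∩ (R ∪ S))
      disjTRS : Empty (T ∩ (R ∪ S))
      rs-differ : (i : Var) (p : i ∈ R) (q : i ∈ S) → r i p ≢ s i q
      singletons-in-T : (i : Var) → d i ≡ zero → i ∈ T
  open Stmt public

  InStar : Stmt → Outcome → Outcome → Set
  InStar φ α β =
    Extends α (u φ) × Extends β (u φ) × Extends α (r φ) × Extends β (s φ)
    × ((i : Var) → i ∈ T φ → α i ≡ β i)

  Sat : LexModel → Stmt → Set₁
  Sat π φ with kind φ
  ... | nonstrict    = ∀ α β → InStar φ α β → α ≽[ π ] β
  ... | fullystrict  = ∀ α β → InStar φ α β → α ≻[ π ] β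
  ... | weaklystrict = (∀ α β → InStar φ α β → α ≽[ π ] β)
                       × ∃ λ α → ∃ λ β → InStar φ α β × α ≻[ π ] β

  data Formula : Set where
    pos : Stmt → Formula
    neg : (φ : Stmt) → kind φ ≡ nonstrict → R φ ≡ S φ → Formula

  _⊨_ : LexModel → Formula → Set₁
  π ⊨ pos φ = Sat π φ
  π ⊨ neg φ _ _ = ¬ Sat π φ

  _⊨*_ : LexModel → Formula → Set₁
  π ⊨* ψ = ∃ λ π' → π' ⊒ π × π' ⊨ ψ

  _⊨Γ_ : LexModel → (Formula → Set) → Set₁
  π ⊨Γ Γ = ∀ ψ → Γ ψ → π ⊨ ψ

  _⊨*Γ_ : LexModel → (Formula → Set) → Set₁
  π ⊨*Γ Γ = ∀ ψ → Γ ψ → π ⊨* ψ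

  RSmeet : LexModel → Stmt → Set₁
  RSmeet π φ = ∃ λ Y → Y ∈ R φ × Y ∈ S φ × InV π Y

  RSjoin : LexModel → Stmt → Set₁
  RSjoin π φ = ∃ λ Y → (Y ∈ R φ ⊎ Y ∈ S φ) × InV π Y

  NotInTU : LexModel → Stmt → Set₁
  NotInTU π φ = ∃ λ Y → InV π Y × Y ∉ T φ × Y ∉ U φ

{-# OPTIONS --safe #-}
module Submission where

-- Non-strict satisfaction is inherited by prefixes of a lex model, which gives (1). Once π
-- satisfies φ non-strictly, a pair of φ* is strictly ordered exactly when it differs somewhere
-- on V_π. Pairs of φ* agree on T ∪ U and differ on R ∩ S; one pair agrees everywhere else, and
-- for each variable of R ∪ S some pair differs there. This gives (2), and (3) except when a
-- strictly ordered pair differs only at variables Y ∈ V_π outside T ∪ U ∪ R ∪ S while V_π misses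
-- R ∪ S. That case is impossible: giving Y the values a ≠ b on the two sides, and then b and a,
-- yields two pairs of φ* that π sees as mirror images, so π cannot order both non-strictly.
-- The same argument, together with the fact that if V_π meets R = S then π and all its
-- extensions satisfy φ strictly, gives (4).

open import Defs
open import Data.Nat using (ℕ)
open import Data.Fin using (Fin)
open import Data.Product using (_×_)
open import Relation.Binary.PropositionalEquality using (_≡_)
open import Function.Bundles using (_⇔_)

open import Level using (lift)
open import Function.Base using (_∘_; id)
open import Function.Bundles using (mk⇔; Equivalence)
open import Data.Nat using (zero) renaming (suc to 1+)
open import Data.Fin using (punchIn; _≟_) renaming (zero to fzero)
open import Data.Fin.Properties using (punchInᵢ≢i)
open import Data.Fin.Subset using (Subset; _∈_; _∉_; _∩_; Empty)
open import Data.Fin.Subset.Properties using (_∈?_; x∈p∩q⁺; x∈p∪q⁺)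
open import Data.Vec.Properties.WithK using ([]=-irrelevant)
open import Data.List using (List; []; _∷_; _++_)
open import Data.List.Relation.Unary.All using (All; []; _∷_)
open import Data.List.Relation.Unary.All.Properties using (Any¬⇒¬All)
open import Data.List.Relation.Unary.Any using (Any; here; there; any?)
open import Data.Product using (∃; ∃₂; _,_; proj₁; proj₂)
open import Data.Sum using (_⊎_; inj₁; inj₂; [_,_])
open import Data.Empty using (⊥-elim)
open import Relation.Binary.Structures using (IsTotalOrder)
open import Relation.Binary.PropositionalEquality using (_≢_; refl; sym; trans; cong; subst; subst₂; module ≡-Reasoning)
open import Relation.Nullary using (¬_; Dec; yes; no)
open import Relation.Nullary.Decidable using (map′; _×-dec_; _⊎-dec_; ¬?)
open import Relation.Unary using (Decidable)

∉-of-Empty-∩ : ∀ {m} {A B : Subset m} {i} → Empty (A ∩ B) → i ∈ A → i ∉ B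
∉-of-Empty-∩ A∩B≡∅ i∈A i∈B = A∩B≡∅ (_ , x∈p∩q⁺ (i∈A , i∈B))

module _ {n : ℕ} {d : Fin n → ℕ} where
  open Setup n d

  EqL : List Entry → Outcome → Outcome → Set₁
  EqL L α β = All (λ e → α (var e) ≡ β (var e)) L

  GeL : List Entry → Outcome → Outcome → Set₁
  GeL L α β = GtL L α β ⊎ EqL L α β

  _∈ᵥ_ : Var → List Entry → Set₁
  Y ∈ᵥ L = Any (λ e → var e ≡ Y) L

  Strict-asym : ∀ e {a b} → Strict e a b → ¬ Strict e b a
  Strict-asym e (lift (a≥b , a≢b)) (lift (b≥a , _)) = a≢b (IsTotalOrder.antisym (isTO e) a≥b b≥a)

  GeL-∷⁺ : ∀ {e L α β} → α (var e) ≡ β (var e) → GeL L α β → GeL (e ∷ L) α β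
  GeL-∷⁺ eq (inj₁ gt)  = inj₁ (inj₂ (lift eq , gt))
  GeL-∷⁺ eq (inj₂ eqs) = inj₂ (eq ∷ eqs)

  GeL-∷⁻ : ∀ {e L α β} → GeL (e ∷ L) α β →
           Strict e (α (var e)) (β (var e)) ⊎ (α (var e) ≡ β (var e) × GeL L α β)
  GeL-∷⁻ (inj₁ (inj₁ gt))             = inj₁ gt
  GeL-∷⁻ (inj₁ (inj₂ (lift eq , gt))) = inj₂ (eq , inj₁ gt)
  GeL-∷⁻ (inj₂ (eq ∷ eqs))            = inj₂ (eq , inj₂ eqs)

  GeL-++⁻ : ∀ L {M α β} → GeL (L ++ M) α β → GeL L α β
  GeL-++⁻ []      _ = inj₂ []
  GeL-++⁻ (e ∷ L) ge with GeL-∷⁻ ge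
  ... | inj₁ gt        = inj₁ (inj₁ gt)
  ... | inj₂ (eq , ge′) = GeL-∷⁺ eq (GeL-++⁻ L ge′)

  GtL-++⁺ : ∀ L {M α β} → GtL L α β → GtL (L ++ M) α β
  GtL-++⁺ (e ∷ L) (inj₁ gt)        = inj₁ gt
  GtL-++⁺ (e ∷ L) (inj₂ (eq , gt)) = inj₂ (eq , GtL-++⁺ L gt)

  GtL⇒Any≢ : ∀ {L α β} → GtL L α β → Any (λ e → α (var e) ≢ β (var e)) L
  GtL⇒Any≢ {e ∷ L} (inj₁ (lift (_ , ≢))) = here ≢
  GtL⇒Any≢ {e ∷ L} (inj₂ (_ , gt))       = there (GtL⇒Any≢ gt)

  GeL-antisym : ∀ L {α β} → GeL L α β → GeL L β α → EqL L α β
  GeL-antisym []      _  _   = []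
  GeL-antisym (e ∷ L) ge ge′ with GeL-∷⁻ ge | GeL-∷⁻ ge′
  ... | inj₁ gt              | inj₁ gt′        = ⊥-elim (Strict-asym e gt gt′)
  ... | inj₁ (lift (_ , ≢))  | inj₂ (eq , _)   = ⊥-elim (≢ (sym eq))
  ... | inj₂ (eq , _)        | inj₁ (lift (_ , ≢)) = ⊥-elim (≢ (sym eq))
  ... | inj₂ (eq , ge₁)      | inj₂ (_ , ge₂)  = eq ∷ GeL-antisym L ge₁ ge₂

  GeL-resp-EqL : ∀ L {α α′ β β′} → EqL L α α′ → EqL L β β′ → GeL L α β → GeL L α′ β′
  GeL-resp-EqL []      []       []       _  = inj₂ []
  GeL-resp-EqL (e ∷ L) (p ∷ ps) (q ∷ qs) ge with GeL-∷⁻ ge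
  ... | inj₁ gt        = inj₁ (inj₁ (subst₂ (Strict e) p q gt))
  ... | inj₂ (eq , ge′) = GeL-∷⁺ (trans (sym p) (trans eq q)) (GeL-resp-EqL L ps qs ge′)

  module _ {P : Var → Set} where

    All-var⁺ : ∀ L → (∀ {Y} → Y ∈ᵥ L → P Y) → All (λ e → P (var e)) L
    All-var⁺ []      _ = []
    All-var⁺ (e ∷ L) f = f (here refl) ∷ All-var⁺ L (f ∘ there)

    All-var⁻ : ∀ L {Y} → All (λ e → P (var e)) L → Y ∈ᵥ L → P Y
    All-var⁻ (e ∷ L) (p ∷ _)  (here refl) = p
    All-var⁻ (e ∷ L) (_ ∷ ps) (there i)   = All-var⁻ L ps i

    Any-var⁺ : ∀ {L Y} → Y ∈ᵥ L → P Y → Any (λ e → P (var e)) L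
    Any-var⁺ (here refl) p = here p
    Any-var⁺ (there i)   p = there (Any-var⁺ i p)

    Any-var⁻ : ∀ {L} → Any (λ e → P (var e)) L → ∃ λ Y → Y ∈ᵥ L × P Y
    Any-var⁻ (here p) = _ , here refl , p
    Any-var⁻ (there a) with Any-var⁻ a
    ... | Y , i , p = Y , there i , p

    ∃InV? : Decidable P → (π : LexModel) → Dec (∃ λ Y → InV π Y × P Y)
    ∃InV? P? π = map′ Any-var⁻ (λ (_ , i , p) → Any-var⁺ i p) (any? (P? ∘ var) (entries π))

  ≡⇒¬≻ : ∀ π {α β} → α ≡[ π ] β → ¬ α ≻[ π ] β
  ≡⇒¬≻ _ eqs gt = Any¬⇒¬All (GtL⇒Any≢ gt) eqs

  ≽∧≢⇒≻ : ∀ π {α β Y} → α ≽[ π ] β → InV π Y → α Y ≢ β Y → α ≻[ π ] β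
  ≽∧≢⇒≻ _ (inj₁ gt)  _ _   = gt
  ≽∧≢⇒≻ _ (inj₂ eqs) i α≢β = ⊥-elim (Any¬⇒¬All (Any-var⁺ i α≢β) eqs)

  ≻⇒∃≢ : ∀ π {α β} → α ≻[ π ] β → ∃ λ Y → InV π Y × α Y ≢ β Y
  ≻⇒∃≢ _ = Any-var⁻ ∘ GtL⇒Any≢

  ≽-prefix : ∀ π π′ {α β} → π′ ⊒ π → α ≽[ π′ ] β → α ≽[ π ] β
  ≽-prefix π _ {α} {β} (rest , eq) ge = GeL-++⁻ (entries π) (subst (λ L → GeL L α β) eq ge)

  ≻-extend : ∀ π π′ {α β} → π′ ⊒ π → α ≻[ π ] β → α ≻[ π′ ] β
  ≻-extend π _ {α} {β} (rest , eq) gt = subst (λ L → GtL L α β) (sym eq) (GtL-++⁺ (entries π) gt)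

  override : ∀ {A} → Assignment A → Outcome → Outcome
  override {A} a γ i with i ∈? A
  ... | yes i∈A = a i i∈A
  ... | no  _   = γ i

  override-extends : ∀ {A} (a : Assignment A) γ → Extends (override a γ) a
  override-extends {A} a γ i i∈A with i ∈? A
  ... | yes i∈A′ = cong (a i) ([]=-irrelevant i∈A′ i∈A)
  ... | no  i∉A  = ⊥-elim (i∉A i∈A)

  override-∉ : ∀ {A} (a : Assignment A) γ {i} → i ∉ A → override a γ i ≡ γ i
  override-∉ {A} a γ {i} i∉A with i ∈? A
  ... | yes i∈A = ⊥-elim (i∉A i∈A)
  ... | no  _   = refl

  override-cong : ∀ {A} (a : Assignment A) {γ δ i} → γ i ≡ δ i → override a γ i ≡ override a δ i
  override-cong {A} a {i = i} γi≡δi with i ∈? A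
  ... | yes _ = refl
  ... | no  _ = γi≡δi

  _[_≔_] : Outcome → (Y : Var) → Dom Y → Outcome
  (γ [ Y ≔ x ]) i with Y ≟ i
  ... | yes refl = x
  ... | no  _    = γ i

  [≔]-≡ : ∀ γ Y x → (γ [ Y ≔ x ]) Y ≡ x
  [≔]-≡ γ Y x with Y ≟ Y
  ... | yes refl = refl
  ... | no  Y≢Y  = ⊥-elim (Y≢Y refl)

  [≔]-∉ : ∀ γ {Y} x {A} → Y ∉ A → ∀ i → i ∈ A → γ i ≡ (γ [ Y ≔ x ]) i
  [≔]-∉ γ {Y} x Y∉A i i∈A with Y ≟ i
  ... | yes refl = ⊥-elim (Y∉A i∈A)
  ... | no  _    = refl

  ζ : Outcome
  ζ _ = fzero

  module _ (φ : Stmt) where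

    ∈R∪S⇒∉U : ∀ {i} → i ∈ R φ ⊎ i ∈ S φ → i ∉ U φ
    ∈R∪S⇒∉U rs i∈U = ∉-of-Empty-∩ (disjURS φ) i∈U (x∈p∪q⁺ rs)

    ∈R∪S⇒∉T : ∀ {i} → i ∈ R φ ⊎ i ∈ S φ → i ∉ T φ
    ∈R∪S⇒∉T rs i∈T = ∉-of-Empty-∩ (disjTRS φ) i∈T (x∈p∪q⁺ rs)

    ∈T⇒∉U : ∀ {i} → i ∈ T φ → i ∉ U φ
    ∈T⇒∉U i∈T i∈U = ∉-of-Empty-∩ (disjUT φ) i∈U i∈T

    φ*-agree : ∀ {α β i} → InStar φ α β → i ∈ T φ ⊎ i ∈ U φ → α i ≡ β i
    φ*-agree (_ , _ , _ , _ , αT≡βT) (inj₁ i∈T) = αT≡βT _ i∈T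
    φ*-agree (αu , βu , _ , _ , _)   (inj₂ i∈U) = trans (αu _ i∈U) (sym (βu _ i∈U))

    φ*-differ : ∀ {α β i} → InStar φ α β → i ∈ R φ → i ∈ S φ → α i ≢ β i
    φ*-differ (_ , _ , αr , βs , _) i∈R i∈S α≡β =
      rs-differ φ _ i∈R i∈S (trans (sym (αr _ i∈R)) (trans α≡β (βs _ i∈S)))

    other-value : ∀ {Y} → Y ∉ T φ → (c : Dom Y) → ∃ λ x → x ≢ c
    other-value {Y} Y∉T c with d Y | singletons-in-T φ Y
    ... | zero | singleton∈T = ⊥-elim (Y∉T (singleton∈T refl))
    ... | 1+ _ | _           = punchIn c fzero , punchInᵢ≢i c fzero

    completeˡ completeʳ : Outcome → Outcome
    completeˡ γ = override (u φ) (override (r φ) γ)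
    completeʳ γ = override (u φ) (override (s φ) γ)

    completeˡ-r : ∀ γ → Extends (completeˡ γ) (r φ)
    completeˡ-r γ i i∈R =
      trans (override-∉ (u φ) _ (∈R∪S⇒∉U (inj₁ i∈R))) (override-extends (r φ) γ i i∈R)

    completeʳ-s : ∀ γ → Extends (completeʳ γ) (s φ)
    completeʳ-s γ i i∈S =
      trans (override-∉ (u φ) _ (∈R∪S⇒∉U (inj₂ i∈S))) (override-extends (s φ) γ i i∈S)

    completeˡ-∉ : ∀ γ {i} → i ∉ U φ → i ∉ R φ → completeˡ γ i ≡ γ i
    completeˡ-∉ γ i∉U i∉R = trans (override-∉ (u φ) _ i∉U) (override-∉ (r φ) γ i∉R)

    completeʳ-∉ : ∀ γ {i} → i ∉ U φ → i ∉ S φ → completeʳ γ i ≡ γ i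
    completeʳ-∉ γ i∉U i∉S = trans (override-∉ (u φ) _ i∉U) (override-∉ (s φ) γ i∉S)

    complete∈φ* : ∀ {γ δ} → (∀ i → i ∈ T φ → γ i ≡ δ i) → InStar φ (completeˡ γ) (completeʳ δ)
    complete∈φ* {γ} {δ} γT≡δT =
      override-extends (u φ) _ , override-extends (u φ) _ , completeˡ-r γ , completeʳ-s δ , T-agree
      where
      T-agree : ∀ i → i ∈ T φ → completeˡ γ i ≡ completeʳ δ i
      T-agree i i∈T = begin
        completeˡ γ i  ≡⟨ completeˡ-∉ γ i∉U (i∉T ∘ inj₁) ⟩
        γ i            ≡⟨ γT≡δT i i∈T ⟩
        δ i            ≡⟨ completeʳ-∉ δ i∉U (i∉T ∘ inj₂) ⟨
        completeʳ δ i  ∎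
        where
        open ≡-Reasoning
        i∉U = ∈T⇒∉U i∈T
        i∉T = λ rs → ∈R∪S⇒∉T rs i∈T

    complete-agree : ∀ γ {i} → i ∉ R φ → i ∉ S φ → completeˡ γ i ≡ completeʳ γ i
    complete-agree γ i∉R i∉S =
      override-cong (u φ) (trans (override-∉ (r φ) γ i∉R) (sym (override-∉ (s φ) γ i∉S)))

    canonicalˡ canonicalʳ : Outcome
    canonicalˡ = completeˡ (completeʳ ζ)
    canonicalʳ = completeʳ (completeˡ ζ)

    canonical∈φ* : InStar φ canonicalˡ canonicalʳ
    canonical∈φ* = complete∈φ* λ i i∈T →
      sym (complete-agree ζ (λ i∈R → ∈R∪S⇒∉T (inj₁ i∈R) i∈T) (λ i∈S → ∈R∪S⇒∉T (inj₂ i∈S) i∈T))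

    canonical-agree : ∀ {i} → ¬ (i ∈ R φ × i ∈ S φ) → canonicalˡ i ≡ canonicalʳ i
    canonical-agree {i} ∉R∩S = override-cong (u φ) (by-cases (i ∈? R φ) (i ∈? S φ))
      where
      by-cases : Dec (i ∈ R φ) → Dec (i ∈ S φ) →
                 override (r φ) (completeʳ ζ) i ≡ override (s φ) (completeˡ ζ) i
      by-cases (yes i∈R) (yes i∈S) = ⊥-elim (∉R∩S (i∈R , i∈S))
      by-cases (yes i∈R) (no  i∉S) =
        trans (override-extends (r φ) _ i i∈R)
              (sym (trans (override-∉ (s φ) _ i∉S) (completeˡ-r ζ i i∈R)))
      by-cases (no  i∉R) (yes i∈S) =
        trans (trans (override-∉ (r φ) _ i∉R) (completeʳ-s ζ i i∈S))
              (sym (override-extends (s φ) _ i i∈S))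
      by-cases (no  i∉R) (no  i∉S) =
        trans (trans (override-∉ (r φ) _ i∉R) (sym (complete-agree ζ i∉R i∉S)))
              (sym (override-∉ (s φ) _ i∉S))

    differing-pair : ∀ {Y} → Y ∈ R φ ⊎ Y ∈ S φ → ∃₂ λ α β → InStar φ α β × α Y ≢ β Y
    differing-pair {Y} Y∈R∪S = by-cases (Y ∈? R φ) (Y ∈? S φ)
      where
      open ≡-Reasoning
      Y∉T = ∈R∪S⇒∉T Y∈R∪S
      Y∉U = ∈R∪S⇒∉U Y∈R∪S

      by-cases : Dec (Y ∈ R φ) → Dec (Y ∈ S φ) → ∃₂ λ α β → InStar φ α β × α Y ≢ β Y
      by-cases (yes Y∈R) (yes Y∈S) =
        let pair∈φ* = complete∈φ* (λ _ _ → refl) in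
        completeˡ ζ , completeʳ ζ , pair∈φ* , φ*-differ pair∈φ* Y∈R Y∈S
      by-cases (yes Y∈R) (no Y∉S) =
        let x , x≢rY = other-value Y∉T (r φ Y Y∈R) in
        completeˡ ζ , completeʳ (ζ [ Y ≔ x ]) , complete∈φ* ([≔]-∉ ζ x Y∉T) ,
        λ eq → x≢rY (begin
          x                          ≡⟨ [≔]-≡ ζ Y x ⟨
          (ζ [ Y ≔ x ]) Y            ≡⟨ completeʳ-∉ _ Y∉U Y∉S ⟨
          completeʳ (ζ [ Y ≔ x ]) Y  ≡⟨ eq ⟨
          completeˡ ζ Y              ≡⟨ completeˡ-r ζ Y Y∈R ⟩
          r φ Y Y∈R                  ∎)
      by-cases (no Y∉R) (yes Y∈S) =
        let x , x≢sY = other-value Y∉T (s φ Y Y∈S) in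
        completeˡ (ζ [ Y ≔ x ]) , completeʳ ζ , complete∈φ* (λ i i∈T → sym ([≔]-∉ ζ x Y∉T i i∈T)) ,
        λ eq → x≢sY (begin
          x                          ≡⟨ [≔]-≡ ζ Y x ⟨
          (ζ [ Y ≔ x ]) Y            ≡⟨ completeˡ-∉ _ Y∉U Y∉R ⟨
          completeˡ (ζ [ Y ≔ x ]) Y  ≡⟨ eq ⟩
          completeʳ ζ Y              ≡⟨ completeʳ-s ζ Y Y∈S ⟩
          s φ Y Y∈S                  ∎)
      by-cases (no Y∉R) (no Y∉S) = ⊥-elim ([ Y∉R , Y∉S ] Y∈R∪S)

  _⊨≥_ _⊨≫_ _⊨>_ : LexModel → Stmt → Set₁
  π ⊨≥ φ = ∀ α β → InStar φ α β → α ≽[ π ] β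
  π ⊨≫ φ = ∀ α β → InStar φ α β → α ≻[ π ] β
  π ⊨> φ = π ⊨≥ φ × ∃₂ λ α β → InStar φ α β × α ≻[ π ] β

  SatAs : Kind → LexModel → Stmt → Set₁
  SatAs nonstrict    = _⊨≥_
  SatAs fullystrict  = _⊨≫_
  SatAs weaklystrict = _⊨>_

  Sat≡SatAs : ∀ {π φ κ} → kind φ ≡ κ → Sat π φ ≡ SatAs κ π φ
  Sat≡SatAs {π} {φ} refl with kind φ
  ... | nonstrict    = refl
  ... | fullystrict  = refl
  ... | weaklystrict = refl

  SatAs⇒⊨≥ : ∀ κ {π φ} → SatAs κ π φ → π ⊨≥ φ
  SatAs⇒⊨≥ nonstrict    sat = sat
  SatAs⇒⊨≥ fullystrict  sat = λ α β αβ∈φ* → inj₁ (sat α β αβ∈φ*)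
  SatAs⇒⊨≥ weaklystrict sat = proj₁ sat

  ⊨*⇒⊨≥ : ∀ π φ → π ⊨* pos φ → π ⊨≥ φ
  ⊨*⇒⊨≥ π φ (π′ , π′⊒π , sat) α β αβ∈φ* =
    ≽-prefix π π′ π′⊒π (SatAs⇒⊨≥ (kind φ) (subst id (Sat≡SatAs refl) sat) α β αβ∈φ*)

  module _ (π : LexModel) (φ : Stmt) where

    RSmeet? : Dec (RSmeet π φ)
    RSmeet? = map′ (λ (Y , i , Y∈R , Y∈S) → Y , Y∈R , Y∈S , i)
                   (λ (Y , Y∈R , Y∈S , i) → Y , i , Y∈R , Y∈S)
                   (∃InV? (λ Y → (Y ∈? R φ) ×-dec (Y ∈? S φ)) π)

    RSjoin? : Dec (RSjoin π φ)
    RSjoin? = map′ (λ (Y , i , Y∈R∪S) → Y , Y∈R∪S , i)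
                   (λ (Y , Y∈R∪S , i) → Y , i , Y∈R∪S)
                   (∃InV? (λ Y → (Y ∈? R φ) ⊎-dec (Y ∈? S φ)) π)

    NotInTU? : Dec (NotInTU π φ)
    NotInTU? = ∃InV? (λ Y → ¬? (Y ∈? T φ) ×-dec ¬? (Y ∈? U φ)) π

    ⊨≫⇒RSmeet : π ⊨≫ φ → RSmeet π φ
    ⊨≫⇒RSmeet sat with RSmeet?
    ... | yes meet = meet
    ... | no ¬meet = ⊥-elim (≡⇒¬≻ π (All-var⁺ (entries π) agree) (sat _ _ (canonical∈φ* φ)))
      where
      agree : ∀ {Y} → InV π Y → canonicalˡ φ Y ≡ canonicalʳ φ Y
      agree i = canonical-agree φ (λ (Y∈R , Y∈S) → ¬meet (_ , Y∈R , Y∈S , i))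

    RSmeet⇒⊨≫ : π ⊨≥ φ → RSmeet π φ → π ⊨≫ φ
    RSmeet⇒⊨≫ sat (_ , Y∈R , Y∈S , i) α β αβ∈φ* =
      ≽∧≢⇒≻ π (sat α β αβ∈φ*) i (φ*-differ φ αβ∈φ* Y∈R Y∈S)

    RSjoin⇒⊨> : π ⊨≥ φ → RSjoin π φ → π ⊨> φ
    RSjoin⇒⊨> sat (_ , Y∈R∪S , i) =
      let α , β , αβ∈φ* , αY≢βY = differing-pair φ Y∈R∪S in
      sat , α , β , αβ∈φ* , ≽∧≢⇒≻ π (sat α β αβ∈φ*) i αY≢βY

    NotInTU∧¬RSjoin⇒⊭≥ : NotInTU π φ → ¬ RSjoin π φ → ¬ π ⊨≥ φ
    NotInTU∧¬RSjoin⇒⊭≥ (Y , i , Y∉T , Y∉U) ¬join sat = b≢ζY (begin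
      b                    ≡⟨ [≔]-≡ ζ Y b ⟨
      γ Y                  ≡⟨ completeʳ-∉ φ γ Y∉U Y∉S ⟨
      completeʳ φ γ Y      ≡⟨ All-var⁻ (entries π) α₁≡β₁ i ⟨
      completeˡ φ ζ Y      ≡⟨ completeˡ-∉ φ ζ Y∉U Y∉R ⟩
      ζ Y                  ∎)
      where
      open ≡-Reasoning
      b = proj₁ (other-value φ Y∉T (ζ Y))
      b≢ζY = proj₂ (other-value φ Y∉T (ζ Y))
      γ = ζ [ Y ≔ b ]
      Y∉R = λ Y∈R → ¬join (Y , inj₁ Y∈R , i)
      Y∉S = λ Y∈S → ¬join (Y , inj₂ Y∈S , i)
      same-background : ∀ δ {Z} → InV π Z → completeˡ φ δ Z ≡ completeʳ φ δ Z
      same-background δ j = complete-agree φ δ (λ Z∈R → ¬join (_ , inj₁ Z∈R , j))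
                                               (λ Z∈S → ¬join (_ , inj₂ Z∈S , j))
      α₁≽β₁ : completeˡ φ ζ ≽[ π ] completeʳ φ γ
      α₁≽β₁ = sat _ _ (complete∈φ* φ ([≔]-∉ ζ b Y∉T))
      α₂≽β₂ : completeˡ φ γ ≽[ π ] completeʳ φ ζ
      α₂≽β₂ = sat _ _ (complete∈φ* φ (λ j j∈T → sym ([≔]-∉ ζ b Y∉T j j∈T)))
      β₁≽α₁ : completeʳ φ γ ≽[ π ] completeˡ φ ζ
      β₁≽α₁ = GeL-resp-EqL (entries π) (All-var⁺ (entries π) (same-background γ))
                                       (All-var⁺ (entries π) (sym ∘ same-background ζ)) α₂≽β₂
      α₁≡β₁ : completeˡ φ ζ ≡[ π ] completeʳ φ γ
      α₁≡β₁ = GeL-antisym (entries π) α₁≽β₁ β₁≽α₁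

    ⊨>⇒RSjoin : π ⊨> φ → RSjoin π φ
    ⊨>⇒RSjoin (sat , α , β , αβ∈φ* , α≻β) with RSjoin?
    ... | yes join = join
    ... | no ¬join =
      let Y , i , αY≢βY = ≻⇒∃≢ π α≻β
          Y∉T∪U = αY≢βY ∘ φ*-agree φ αβ∈φ*
      in ⊥-elim (NotInTU∧¬RSjoin⇒⊭≥ (Y , i , Y∉T∪U ∘ inj₁ , Y∉T∪U ∘ inj₂) ¬join sat)

    ⊨≫⇔RSmeet : π ⊨≥ φ → (π ⊨≫ φ ⇔ RSmeet π φ)
    ⊨≫⇔RSmeet sat = mk⇔ ⊨≫⇒RSmeet (RSmeet⇒⊨≫ sat)

    ⊨>⇔RSjoin : π ⊨≥ φ → (π ⊨> φ ⇔ RSjoin π φ)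
    ⊨>⇔RSjoin sat = mk⇔ ⊨>⇒RSjoin (RSjoin⇒⊨> sat)

    ¬NotInTU⇒⊨≥ : ¬ NotInTU π φ → π ⊨≥ φ
    ¬NotInTU⇒⊨≥ ¬notInTU α β αβ∈φ* = inj₂ (All-var⁺ (entries π) (φ*-agree φ αβ∈φ* ∘ ∈T∪U))
      where
      ∈T∪U : ∀ {Y} → InV π Y → Y ∈ T φ ⊎ Y ∈ U φ
      ∈T∪U {Y} i with Y ∈? T φ | Y ∈? U φ
      ... | yes Y∈T | _       = inj₁ Y∈T
      ... | no  _   | yes Y∈U = inj₂ Y∈U
      ... | no  Y∉T | no  Y∉U = ⊥-elim (¬notInTU (Y , i , Y∉T , Y∉U))

    ⊭≥⇔NotInTU : R φ ≡ S φ → ∀ π′ → π′ ⊒ π → ¬ π′ ⊨≥ φ → ((¬ π ⊨≥ φ) ⇔ NotInTU π φ)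
    ⊭≥⇔NotInTU R≡S π′ π′⊒π π′⊭φ = mk⇔ ⊭≥⇒NotInTU NotInTU⇒⊭≥
      where
      ⊭≥⇒NotInTU : ¬ π ⊨≥ φ → NotInTU π φ
      ⊭≥⇒NotInTU π⊭φ with NotInTU?
      ... | yes notInTU = notInTU
      ... | no ¬notInTU = ⊥-elim (π⊭φ (¬NotInTU⇒⊨≥ ¬notInTU))

      RSjoin⇒RSmeet : RSjoin π φ → RSmeet π φ
      RSjoin⇒RSmeet (Y , inj₁ Y∈R , i) = Y , Y∈R , subst (Y ∈_) R≡S Y∈R , i
      RSjoin⇒RSmeet (Y , inj₂ Y∈S , i) = Y , subst (Y ∈_) (sym R≡S) Y∈S , Y∈S , i

      NotInTU⇒⊭≥ : NotInTU π φ → ¬ π ⊨≥ φ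
      NotInTU⇒⊭≥ notInTU sat with RSjoin?
      ... | no ¬join = NotInTU∧¬RSjoin⇒⊭≥ notInTU ¬join sat
      ... | yes join = π′⊭φ λ α β αβ∈φ* →
        inj₁ (≻-extend π π′ π′⊒π (RSmeet⇒⊨≫ sat (RSjoin⇒RSmeet join) α β αβ∈φ*))

  ⊨*⇒Sat : ∀ π φ → kind φ ≡ nonstrict → π ⊨* pos φ → Sat π φ
  ⊨*⇒Sat π φ k π⊨*φ = subst id (sym (Sat≡SatAs k)) (⊨*⇒⊨≥ π φ π⊨*φ)

  ⊨*⇒Sat⇔RSmeet : ∀ π φ → kind φ ≡ fullystrict → π ⊨* pos φ → (Sat π φ ⇔ RSmeet π φ)
  ⊨*⇒Sat⇔RSmeet π φ k π⊨*φ =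
    subst (_⇔ RSmeet π φ) (sym (Sat≡SatAs k)) (⊨≫⇔RSmeet π φ (⊨*⇒⊨≥ π φ π⊨*φ))

  ⊨*⇒Sat⇔RSjoin : ∀ π φ → kind φ ≡ weaklystrict → π ⊨* pos φ → (Sat π φ ⇔ RSjoin π φ)
  ⊨*⇒Sat⇔RSjoin π φ k π⊨*φ =
    subst (_⇔ RSjoin π φ) (sym (Sat≡SatAs k)) (⊨>⇔RSjoin π φ (⊨*⇒⊨≥ π φ π⊨*φ))

  ⊨*⇒⊨neg⇔NotInTU : ∀ π φ k e → π ⊨* neg φ k e → (π ⊨ neg φ k e ⇔ NotInTU π φ)
  ⊨*⇒⊨neg⇔NotInTU π φ k e (π′ , π′⊒π , π′⊭φ) =
    subst (λ X → (¬ X) ⇔ NotInTU π φ) (sym (Sat≡SatAs k))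
          (⊭≥⇔NotInTU π φ e π′ π′⊒π (subst ¬_ (Sat≡SatAs k) π′⊭φ))

proposition15 : (n : ℕ) (d : Fin n → ℕ) → let open Setup n d in
    (Γ : Formula → Set) (π : LexModel) → π ⊨*Γ Γ →
      ((φ : Stmt) → Γ (pos φ) → kind φ ≡ nonstrict → π ⊨ pos φ)
      × ((φ : Stmt) → Γ (pos φ) → kind φ ≡ fullystrict → (π ⊨ pos φ ⇔ RSmeet π φ))
      × ((φ : Stmt) → Γ (pos φ) → kind φ ≡ weaklystrict → (π ⊨ pos φ ⇔ RSjoin π φ))
      × ((φ : Stmt) (k : kind φ ≡ nonstrict) (e : R φ ≡ S φ) → Γ (neg φ k e)
          → (π ⊨ neg φ k e ⇔ NotInTU π φ))
      × (π ⊨Γ Γ ⇔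
          (((φ : Stmt) → Γ (pos φ) → kind φ ≡ fullystrict → RSmeet π φ)
          × ((φ : Stmt) → Γ (pos φ) → kind φ ≡ weaklystrict → RSjoin π φ)
          × ((φ : Stmt) (k : kind φ ≡ nonstrict) (e : R φ ≡ S φ) → Γ (neg φ k e)
              → NotInTU π φ)))
proposition15 n d Γ π π⊨*Γ = part₁ , part₂ , part₃ , part₄ , mk⇔ conditions satisfied
  where
  open Setup n d
  open Equivalence using (to; from)

  part₁ : ∀ φ → Γ (pos φ) → kind φ ≡ nonstrict → π ⊨ pos φ
  part₁ φ φ∈Γ k = ⊨*⇒Sat π φ k (π⊨*Γ _ φ∈Γ)

  part₂ : ∀ φ → Γ (pos φ) → kind φ ≡ fullystrict → (π ⊨ pos φ ⇔ RSmeet π φ)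
  part₂ φ φ∈Γ k = ⊨*⇒Sat⇔RSmeet π φ k (π⊨*Γ _ φ∈Γ)

  part₃ : ∀ φ → Γ (pos φ) → kind φ ≡ weaklystrict → (π ⊨ pos φ ⇔ RSjoin π φ)
  part₃ φ φ∈Γ k = ⊨*⇒Sat⇔RSjoin π φ k (π⊨*Γ _ φ∈Γ)

  part₄ : ∀ φ k e → Γ (neg φ k e) → (π ⊨ neg φ k e ⇔ NotInTU π φ)
  part₄ φ k e ¬φ∈Γ = ⊨*⇒⊨neg⇔NotInTU π φ k e (π⊨*Γ _ ¬φ∈Γ)

  Conditions : Set₁
  Conditions = ((φ : Stmt) → Γ (pos φ) → kind φ ≡ fullystrict → RSmeet π φ)
             × ((φ : Stmt) → Γ (pos φ) → kind φ ≡ weaklystrict → RSjoin π φ)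
             × ((φ : Stmt) (k : kind φ ≡ nonstrict) (e : R φ ≡ S φ) → Γ (neg φ k e) → NotInTU π φ)

  conditions : π ⊨Γ Γ → Conditions
  conditions sat =
    (λ φ φ∈Γ k → to (part₂ φ φ∈Γ k) (sat _ φ∈Γ)) ,
    (λ φ φ∈Γ k → to (part₃ φ φ∈Γ k) (sat _ φ∈Γ)) ,
    (λ φ k e ¬φ∈Γ → to (part₄ φ k e ¬φ∈Γ) (sat _ ¬φ∈Γ))

  satisfied : Conditions → π ⊨Γ Γ
  satisfied (_ , _ , notInTU) (neg φ k e) ¬φ∈Γ = from (part₄ φ k e ¬φ∈Γ) (notInTU φ k e ¬φ∈Γ)
  satisfied (meet , join , _) (pos φ) φ∈Γ = by-kind (kind φ) refl
    where
    by-kind : ∀ κ → kind φ ≡ κ → π ⊨ pos φ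
    by-kind nonstrict    k = part₁ φ φ∈Γ k
    by-kind fullystrict  k = from (part₂ φ φ∈Γ k) (meet φ φ∈Γ k)
    by-kind weaklystrict k = from (part₃ φ φ∈Γ k) (join φ φ∈Γ k)
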